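{- For every $n\in\mathbb{N}_0$, \[ P_{n}(0)=y_{6}(0,n;-1,2)\sum_{k=0}^{n}s(n,k)E_{k}, \] where $y_6(0,n;-1,2)=\frac{1}{n!}\sum_{k=0}^{n}(-1)^k\binom{n}{k}^{2}$.
   Context: $P_n(x)$ is the Legendre polynomial, defined by $\frac{1}{\sqrt{1-2xt+t^2}}=\sum_{n\ge0}P_n(x)t^n$. $E_k$ are the Euler numbers, defined by $\frac{2}{e^t+1}=\sum_{k\ge0}E_k\frac{t^k}{k!}$. $s(n,k)$ are the Stirling numbers of the first kind, defined by $\frac{(\log(1+t))^k}{k!}=\sum_{n\ge0}s(n,k)\frac{t^n}{n!}$. -}

module Defs where

open import Data.Nat as ℕ using (ℕ; zero; suc; _∸_; _!)
open import Data.Nat.Properties using (_!≢0)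
open import Data.Nat.Combinatorics using (_C_)
open import Data.Integer as ℤ using (ℤ; +_; -[1+_])
open import Data.Rational using (ℚ; 0ℚ; 1ℚ; _+_; _*_; -_; _/_)

FPS : Set
FPS = ℕ → ℚ

sumTo : ℕ → (ℕ → ℚ) → ℚ
sumTo zero    f = f 0
sumTo (suc n) f = sumTo n f + f (suc n)

ℕ→ℚ : ℕ → ℚ
ℕ→ℚ n = + n / 1

inv! : ℕ → ℚ
inv! n = (+ 1 / (n !)) {{n !≢0}}

sgn : ℕ → ℚ
sgn zero    = 1ℚ
sgn (suc m) = - sgn m

_⊛_ : FPS → FPS → FPS
(f ⊛ g) n = sumTo n (λ i → f i * g (n ∸ i))

oneS : FPS
oneS zero    = 1ℚ
oneS (suc _) = 0ℚ

powS : FPS → ℕ → FPS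
powS f zero    = oneS
powS f (suc m) = f ⊛ powS f m

-- Composition (Σ_m a_m X^m) ∘ u for a series u with zero constant term:
-- the coefficient of t^n only involves m ≤ n (u^m has order ≥ m).
compose : (ℕ → ℚ) → FPS → FPS
compose a u n = sumTo n (λ m → a m * powS u m n)

-- Legendre polynomials:  (1 - 2xt + t²)^(-1/2) = Σ P_n(x) tⁿ
-- computed as the binomial series (1+u)^(-1/2) = Σ_m C(-1/2,m) u^m
-- with u = -2xt + t².

halfFall : ℕ → ℚ
halfFall zero    = 1ℚ
halfFall (suc m) = halfFall m * (- ((+ 1 / 2) + ℕ→ℚ m))

binomNegHalf : ℕ → ℚ
binomNegHalf m = halfFall m * inv! m

legendreU : ℚ → FPS
legendreU x 1 = - ((+ 2 / 1) * x)
legendreU x 2 = 1ℚ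
legendreU x _ = 0ℚ

P : ℕ → ℚ → ℚ
P n x = compose binomNegHalf (legendreU x) n

-- Euler numbers:  2/(eᵗ+1) = Σ E_k tᵏ/k!
-- computed as 1/(1+u) = Σ_m (-1)^m u^m with u = (eᵗ-1)/2.

eulerU : FPS
eulerU zero    = 0ℚ
eulerU (suc k) = (+ 1 / 2) * inv! (suc k)

E : ℕ → ℚ
E k = ℕ→ℚ (k !) * compose sgn eulerU k

-- Stirling numbers of the first kind (signed):
-- (log(1+t))^k / k! = Σ s(n,k) tⁿ/n!,  log(1+t) = Σ_{m≥1} (-1)^(m+1) t^m / m.

logS : FPS
logS zero    = 0ℚ
logS (suc m) = sgn m * (+ 1 / suc m)

s : ℕ → ℕ → ℚ
s n k = ℕ→ℚ (n !) * (powS logS k n * inv! k)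

y6 : ℕ → ℚ
y6 n = inv! n * sumTo n (λ k → sgn k * ℕ→ℚ ((n C k) ℕ.* (n C k)))

module Submission where

-- Both sides are computed in closed form, separately for n = 2j and n = 2j+1.
--
-- * Σ_k s(n,k) E_k = n! (-1/2)ⁿ.  With u = (eᵗ-1)/2 and L = log(1+t) we have
--   E_k/k! = [t^k] Σ_m (-1)^m u^m and s(n,k)/n! = [tⁿ] L^k/k!, so after exchanging
--   the finite sums the left side is n! Σ_m (-1)^m [tⁿ] (u^m ∘ L).  Since u ∘ L = t/2
--   this is n! (-1)ⁿ/2ⁿ.  Instead of a general theory of composition we prove
--   u^m ∘ L = (t/2)^m from differential equations: the chain rule
--   (1+t)(f ∘ L)' = f' ∘ L, the identity (u^{m+1})' = (m+1)(u^{m+1} + u^m/2), and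
--   the fact that the recurrence (1+t) f' = … determines f from f(0).
-- * Σ_k (-1)^k C(n,k)² = [tⁿ] (1-t)ⁿ(1+t)ⁿ = [tⁿ] (1-t²)ⁿ, which is 0 for odd n and
--   (-1)^j C(2j,j) for n = 2j (by Pascal's rule, (1-t²)^{n+1} = (1-t²)ⁿ - t²(1-t²)ⁿ).
-- * P_n(0) = [tⁿ] Σ_m C(-1/2,m) t^{2m}: 0 for odd n and C(-1/2,j) = (-1)^j C(2j,j)/4^j
--   for n = 2j.

open import Defs
open import Data.Nat as ℕ using (ℕ; zero; suc; _∸_; _!; z≤n; s≤s; _≤_; _<_)
import Data.Nat.Properties as NP
open import Data.Nat.Combinatorics
  using (_C_; nCk+nC[k+1]≡[n+1]C[k+1]; nCk≡nC[n∸k]; nCk≡n!/k![n-k]!; k![n∸k]!∣n!)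
import Data.Nat.DivMod as DM
open import Data.Integer as ℤ using (+_)
import Data.Integer.Properties as ZP
open import Data.Rational using (ℚ; 0ℚ; 1ℚ; _+_; _*_; -_; _/_; toℚᵘ)
import Data.Rational.Properties as QP
import Data.Rational.Unnormalised as U
import Data.Rational.Unnormalised.Properties as UP
import Algebra.Properties.Group as GroupProperties
open import Data.Rational.Solver
open +-*-Solver
open import Data.Empty using (⊥-elim)
open import Function using (_∘_)
open import Data.Sum using (inj₁; inj₂)
open import Relation.Nullary using (¬_; Dec; yes; no)
open import Relation.Binary.PropositionalEquality
open ≡-Reasoning

open GroupProperties QP.+-0-group using () renaming (∙-cancelʳ to +-cancelʳ)

-- Natural numbers inside ℚ.  The embedding ℕ→ℚ n = n/1 is a semiring map; the
-- proofs go through unnormalised fractions, where the identities hold by ℤ-algebra.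

toℚᵘ-/ : ∀ a d → toℚᵘ (+ a / suc d) U.≃ U.mkℚᵘ (+ a) d
toℚᵘ-/ a d = QP.toℚᵘ-fromℚᵘ (U.mkℚᵘ (+ a) d)

ℕ→ℚ-+ : ∀ a b → ℕ→ℚ (a ℕ.+ b) ≡ ℕ→ℚ a + ℕ→ℚ b
ℕ→ℚ-+ a b = QP.toℚᵘ-injective (UP.≃-trans (toℚᵘ-/ (a ℕ.+ b) 0) (UP.≃-sym (UP.≃-trans
  (QP.toℚᵘ-homo-+ (ℕ→ℚ a) (ℕ→ℚ b)) (UP.≃-trans (UP.+-cong (toℚᵘ-/ a 0) (toℚᵘ-/ b 0)) (U.*≡* eq)))))
  where
  eq : (+ a ℤ.* + 1 ℤ.+ + b ℤ.* + 1) ℤ.* + 1 ≡ + (a ℕ.+ b) ℤ.* + 1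
  eq = cong (ℤ._* + 1) (trans (cong₂ ℤ._+_ (ZP.*-identityʳ (+ a)) (ZP.*-identityʳ (+ b))) (sym (ZP.pos-+ a b)))

ℕ→ℚ-suc : ∀ n → ℕ→ℚ (suc n) ≡ 1ℚ + ℕ→ℚ n
ℕ→ℚ-suc = ℕ→ℚ-+ 1

ℕ→ℚ-* : ∀ a b → ℕ→ℚ (a ℕ.* b) ≡ ℕ→ℚ a * ℕ→ℚ b
ℕ→ℚ-* a b = QP.toℚᵘ-injective (UP.≃-trans (toℚᵘ-/ (a ℕ.* b) 0) (UP.≃-sym (UP.≃-trans
  (QP.toℚᵘ-homo-* (ℕ→ℚ a) (ℕ→ℚ b)) (UP.≃-trans (UP.*-cong (toℚᵘ-/ a 0) (toℚᵘ-/ b 0)) (U.*≡* eq)))))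
  where
  eq : (+ a ℤ.* + b) ℤ.* + 1 ≡ + (a ℕ.* b) ℤ.* + 1
  eq = cong (ℤ._* + 1) (sym (ZP.pos-* a b))

ℕ→ℚ-inverse : ∀ m .{{_ : ℕ.NonZero m}} → (+ 1 / m) * ℕ→ℚ m ≡ 1ℚ
ℕ→ℚ-inverse (suc d) = QP.toℚᵘ-injective (UP.≃-trans (QP.toℚᵘ-homo-* (+ 1 / suc d) (ℕ→ℚ (suc d)))
  (UP.≃-trans (UP.*-cong (toℚᵘ-/ 1 d) (toℚᵘ-/ (suc d) 0)) (U.*≡* (eq (suc (d ℕ.* 1)) (cong suc (NP.*-identityʳ d))))))
  where
  -- the product's denominator is only propositionally equal to 1+d
  eq : ∀ a → a ≡ suc d → (+ 1 ℤ.* + suc d) ℤ.* + 1 ≡ + 1 ℤ.* + a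
  eq a refl = ZP.*-identityʳ _

inv!-inverse : ∀ k → inv! k * ℕ→ℚ (k !) ≡ 1ℚ
inv!-inverse k = ℕ→ℚ-inverse (k !) {{k NP.!≢0}}

-- 1/(k+1)! · (k+1) = 1/k!, the coefficient identity behind (eᵗ)' = eᵗ.
inv!-suc : ∀ k → inv! (suc k) * ℕ→ℚ (suc k) ≡ inv! k
inv!-suc k = begin
  A * B                   ≡⟨ sym (QP.*-identityʳ (A * B)) ⟩
  A * B * 1ℚ              ≡⟨ cong (A * B *_) (sym (inv!-inverse k)) ⟩
  A * B * (I * F)         ≡⟨ solve 4 (λ a b i f → a :* b :* (i :* f) := i :* (a :* (b :* f))) refl A B I F ⟩
  I * (A * (B * F))       ≡⟨ cong (λ z → I * (A * z)) (sym (ℕ→ℚ-* (suc k) (k !))) ⟩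
  I * (A * ℕ→ℚ (suc k !)) ≡⟨ cong (I *_) (inv!-inverse (suc k)) ⟩
  I * 1ℚ                  ≡⟨ QP.*-identityʳ I ⟩
  I                       ∎
  where A = inv! (suc k) ; B = ℕ→ℚ (suc k) ; I = inv! k ; F = ℕ→ℚ (k !)

ℕ→ℚ-cancel : ∀ n {x y} → ℕ→ℚ (suc n) * x ≡ ℕ→ℚ (suc n) * y → x ≡ y
ℕ→ℚ-cancel n {x} {y} e = begin
  x           ≡⟨ sym (QP.*-identityˡ x) ⟩
  1ℚ * x      ≡⟨ cong (_* x) (sym (ℕ→ℚ-inverse (suc n))) ⟩
  (I * N) * x ≡⟨ QP.*-assoc I N x ⟩
  I * (N * x) ≡⟨ cong (I *_) e ⟩
  I * (N * y) ≡⟨ sym (QP.*-assoc I N y) ⟩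
  (I * N) * y ≡⟨ cong (_* y) (ℕ→ℚ-inverse (suc n)) ⟩
  1ℚ * y      ≡⟨ QP.*-identityˡ y ⟩
  y           ∎
  where I = + 1 / suc n ; N = ℕ→ℚ (suc n)

sgn-suc-suc : ∀ m → sgn (suc (suc m)) ≡ sgn m
sgn-suc-suc m = solve 1 (λ x → :- (:- x) := x) refl (sgn m)

sgn-even : ∀ j → sgn (j ℕ.+ j) ≡ 1ℚ
sgn-even zero    = refl
sgn-even (suc j) = begin
  sgn (suc (j ℕ.+ suc j))   ≡⟨ cong (λ z → sgn (suc z)) (NP.+-suc j j) ⟩
  sgn (suc (suc (j ℕ.+ j))) ≡⟨ sgn-suc-suc (j ℕ.+ j) ⟩
  sgn (j ℕ.+ j)             ≡⟨ sgn-even j ⟩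
  1ℚ                        ∎

sumTo-cong : ∀ n {f g : ℕ → ℚ} → (∀ i → i ≤ n → f i ≡ g i) → sumTo n f ≡ sumTo n g
sumTo-cong zero    h = h 0 z≤n
sumTo-cong (suc n) h = cong₂ _+_ (sumTo-cong n (λ i p → h i (NP.m≤n⇒m≤1+n p))) (h (suc n) NP.≤-refl)

sumTo-+ : ∀ n (f g : ℕ → ℚ) → sumTo n (λ i → f i + g i) ≡ sumTo n f + sumTo n g
sumTo-+ zero    f g = refl
sumTo-+ (suc n) f g = trans (cong (_+ (f (suc n) + g (suc n))) (sumTo-+ n f g))
  (solve 4 (λ a b c d → (a :+ b) :+ (c :+ d) := (a :+ c) :+ (b :+ d)) refl
    (sumTo n f) (sumTo n g) (f (suc n)) (g (suc n)))

sumTo-*ˡ : ∀ n c (f : ℕ → ℚ) → sumTo n (λ i → c * f i) ≡ c * sumTo n f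
sumTo-*ˡ zero    c f = refl
sumTo-*ˡ (suc n) c f = trans (cong (_+ (c * f (suc n))) (sumTo-*ˡ n c f)) (sym (QP.*-distribˡ-+ c _ _))

sumTo-*ʳ : ∀ n c (f : ℕ → ℚ) → sumTo n (λ i → f i * c) ≡ sumTo n f * c
sumTo-*ʳ n c f = trans (sumTo-cong n (λ i _ → QP.*-comm (f i) c)) (trans (sumTo-*ˡ n c f) (QP.*-comm c _))

sumTo-zero : ∀ n (f : ℕ → ℚ) → (∀ i → i ≤ n → f i ≡ 0ℚ) → sumTo n f ≡ 0ℚ
sumTo-zero zero    f h = h 0 z≤n
sumTo-zero (suc n) f h = cong₂ _+_ (sumTo-zero n f (λ i p → h i (NP.m≤n⇒m≤1+n p))) (h (suc n) NP.≤-refl)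

sumTo-peel : ∀ n (f : ℕ → ℚ) → sumTo (suc n) f ≡ f 0 + sumTo n (λ i → f (suc i))
sumTo-peel zero    f = refl
sumTo-peel (suc n) f = trans (cong (_+ f (suc (suc n))) (sumTo-peel n f)) (QP.+-assoc (f 0) _ _)

sumTo-extend : ∀ {n m} (f : ℕ → ℚ) → n ≤ m → (∀ i → n < i → f i ≡ 0ℚ) → sumTo m f ≡ sumTo n f
sumTo-extend {n} {m} f n≤m h = trans (cong (λ z → sumTo z f) (sym (NP.m+[n∸m]≡n n≤m))) (extend (m ∸ n))
  where
  extend : ∀ k → sumTo (n ℕ.+ k) f ≡ sumTo n f
  extend zero    = cong (λ z → sumTo z f) (NP.+-identityʳ n)
  extend (suc k) = begin
    sumTo (n ℕ.+ suc k) f                    ≡⟨ cong (λ z → sumTo z f) (NP.+-suc n k) ⟩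
    sumTo (n ℕ.+ k) f + f (suc (n ℕ.+ k))    ≡⟨ cong₂ _+_ (extend k) (h (suc (n ℕ.+ k)) (s≤s (NP.m≤m+n n k))) ⟩
    sumTo n f + 0ℚ                           ≡⟨ QP.+-identityʳ _ ⟩
    sumTo n f                                ∎

sumTo-single : ∀ n j (f : ℕ → ℚ) → j ≤ n → (∀ i → i ≤ n → ¬ i ≡ j → f i ≡ 0ℚ) → sumTo n f ≡ f j
sumTo-single zero zero f p h = refl
sumTo-single (suc n) j f p h with j ℕ.≟ suc n
... | yes refl = trans (cong (_+ f (suc n)) (sumTo-zero n f below)) (QP.+-identityˡ _)
  where
  below : ∀ i → i ≤ n → f i ≡ 0ℚ
  below i i≤n = h i (NP.m≤n⇒m≤1+n i≤n) (λ i≡1+n → NP.<-irrefl i≡1+n (s≤s i≤n))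
... | no j≢1+n = trans (cong₂ _+_ (sumTo-single n j f j≤n (λ i i≤n → h i (NP.m≤n⇒m≤1+n i≤n)))
                                  (h (suc n) NP.≤-refl (j≢1+n ∘ sym)))
                       (QP.+-identityʳ _)
  where
  j≤n : j ≤ n
  j≤n = NP.≤-pred (NP.≤∧≢⇒< p j≢1+n)

sumTo-swap : ∀ n m (h : ℕ → ℕ → ℚ) →
             sumTo n (λ i → sumTo m (λ j → h i j)) ≡ sumTo m (λ j → sumTo n (λ i → h i j))
sumTo-swap zero    m h = refl
sumTo-swap (suc n) m h = trans (cong (_+ sumTo m (h (suc n))) (sumTo-swap n m h)) (sym (sumTo-+ m _ _))

deriv : FPS → FPS
deriv f n = ℕ→ℚ (suc n) * f (suc n)

mulT : FPS → FPS
mulT f zero    = 0ℚ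
mulT f (suc n) = f n

mulT-cong : ∀ {f g : FPS} → (∀ m → f m ≡ g m) → ∀ n → mulT f n ≡ mulT g n
mulT-cong e zero    = refl
mulT-cong e (suc n) = e n

mulT-+ : ∀ (f g : FPS) n → mulT (λ m → f m + g m) n ≡ mulT f n + mulT g n
mulT-+ f g zero    = refl
mulT-+ f g (suc n) = refl

⊛-congˡ : ∀ {f f′ : FPS} (g : FPS) → (∀ k → f k ≡ f′ k) → ∀ n → (f ⊛ g) n ≡ (f′ ⊛ g) n
⊛-congˡ g e n = sumTo-cong n (λ i _ → cong (_* g (n ∸ i)) (e i))

⊛-congʳ : ∀ (f : FPS) {g g′ : FPS} → (∀ k → g k ≡ g′ k) → ∀ n → (f ⊛ g) n ≡ (f ⊛ g′) n
⊛-congʳ f e n = sumTo-cong n (λ i _ → cong (f i *_) (e (n ∸ i)))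

⊛-+ˡ : ∀ (f g h : FPS) n → ((λ k → f k + g k) ⊛ h) n ≡ (f ⊛ h) n + (g ⊛ h) n
⊛-+ˡ f g h n = trans (sumTo-cong n (λ i _ → QP.*-distribʳ-+ (h (n ∸ i)) (f i) (g i))) (sumTo-+ n _ _)

⊛-+ʳ : ∀ (f g h : FPS) n → (f ⊛ (λ k → g k + h k)) n ≡ (f ⊛ g) n + (f ⊛ h) n
⊛-+ʳ f g h n = trans (sumTo-cong n (λ i _ → QP.*-distribˡ-+ (f i) (g (n ∸ i)) (h (n ∸ i)))) (sumTo-+ n _ _)

⊛-*ˡ : ∀ c (f g : FPS) n → ((λ k → c * f k) ⊛ g) n ≡ c * (f ⊛ g) n
⊛-*ˡ c f g n = trans (sumTo-cong n (λ i _ → QP.*-assoc c (f i) (g (n ∸ i)))) (sumTo-*ˡ n c _)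

⊛-*ʳ : ∀ c (f g : FPS) n → (f ⊛ (λ k → c * g k)) n ≡ c * (f ⊛ g) n
⊛-*ʳ c f g n = trans (sumTo-cong n (λ i _ → swap (f i) c (g (n ∸ i)))) (sumTo-*ˡ n c _)
  where
  swap : ∀ x a y → x * (a * y) ≡ a * (x * y)
  swap = solve 3 (λ x a y → x :* (a :* y) := a :* (x :* y)) refl

⊛-zeroʳ : ∀ (f g : FPS) → (∀ k → g k ≡ 0ℚ) → ∀ n → (f ⊛ g) n ≡ 0ℚ
⊛-zeroʳ f g e n = sumTo-zero n _ (λ i _ → trans (cong (f i *_) (e (n ∸ i))) (QP.*-zeroʳ (f i)))

oneS-⊛ : ∀ (g : FPS) n → (oneS ⊛ g) n ≡ g n
oneS-⊛ g n = trans (sumTo-single n 0 _ z≤n others) (QP.*-identityˡ (g n))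
  where
  others : ∀ i → i ≤ n → ¬ i ≡ 0 → oneS i * g (n ∸ i) ≡ 0ℚ
  others zero    _ i≢0 = ⊥-elim (i≢0 refl)
  others (suc i) _ _   = QP.*-zeroˡ (g (n ∸ suc i))

⊛-oneS : ∀ (f : FPS) n → (f ⊛ oneS) n ≡ f n
⊛-oneS f n = trans (sumTo-single n n _ NP.≤-refl others)
                   (trans (cong (λ z → f n * oneS z) (NP.n∸n≡0 n)) (QP.*-identityʳ (f n)))
  where
  oneS-pos : ∀ m → 0 < m → oneS m ≡ 0ℚ
  oneS-pos (suc m) _ = refl
  others : ∀ i → i ≤ n → ¬ i ≡ n → f i * oneS (n ∸ i) ≡ 0ℚ
  others i i≤n i≢n = trans (cong (f i *_) (oneS-pos (n ∸ i) (NP.m<n⇒0<n∸m (NP.≤∧≢⇒< i≤n i≢n))))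
                           (QP.*-zeroʳ (f i))

mulT-⊛ˡ : ∀ (f g : FPS) n → (mulT f ⊛ g) n ≡ mulT (f ⊛ g) n
mulT-⊛ˡ f g zero    = QP.*-zeroˡ (g 0)
mulT-⊛ˡ f g (suc n) = trans (sumTo-peel n _)
  (trans (cong (_+ (f ⊛ g) n) (QP.*-zeroˡ (g (suc n)))) (QP.+-identityˡ ((f ⊛ g) n)))

mulT-⊛ʳ : ∀ (f g : FPS) n → (f ⊛ mulT g) n ≡ mulT (f ⊛ g) n
mulT-⊛ʳ f g zero    = QP.*-zeroʳ (f 0)
mulT-⊛ʳ f g (suc n) = trans
  (cong₂ _+_ (sumTo-cong n (λ i i≤n → cong (λ z → f i * mulT g z) (NP.+-∸-assoc 1 i≤n)))
             (trans (cong (λ z → f (suc n) * mulT g z) (NP.n∸n≡0 n)) (QP.*-zeroʳ (f (suc n)))))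
  (QP.+-identityʳ ((f ⊛ g) n))

-- Leibniz rule (fg)' = f'g + fg', coefficientwise: split (n+1) = i + (n+1-i).
deriv-⊛ : ∀ (f g : FPS) n → deriv (f ⊛ g) n ≡ (deriv f ⊛ g) n + (f ⊛ deriv g) n
deriv-⊛ f g n = begin
  N * sumTo (suc n) t
    ≡⟨ sym (sumTo-*ˡ (suc n) N t) ⟩
  sumTo (suc n) (λ i → N * t i)
    ≡⟨ sumTo-cong (suc n) split ⟩
  sumTo (suc n) (λ i → ℕ→ℚ i * t i + ℕ→ℚ (suc n ∸ i) * t i)
    ≡⟨ sumTo-+ (suc n) _ _ ⟩
  sumTo (suc n) (λ i → ℕ→ℚ i * t i) + sumTo (suc n) (λ i → ℕ→ℚ (suc n ∸ i) * t i)
    ≡⟨ cong₂ _+_ left right ⟩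
  (deriv f ⊛ g) n + (f ⊛ deriv g) n ∎
  where
  N = ℕ→ℚ (suc n)
  t : ℕ → ℚ
  t i = f i * g (suc n ∸ i)
  split : ∀ i → i ≤ suc n → N * t i ≡ ℕ→ℚ i * t i + ℕ→ℚ (suc n ∸ i) * t i
  split i i≤n = trans (cong (λ z → ℕ→ℚ z * t i) (sym (NP.m+[n∸m]≡n i≤n)))
    (trans (cong (_* t i) (ℕ→ℚ-+ i (suc n ∸ i))) (QP.*-distribʳ-+ (t i) (ℕ→ℚ i) (ℕ→ℚ (suc n ∸ i))))
  -- the i = 0 term has weight 0; the others give (deriv f)(i-1) g(n+1-i)
  left : sumTo (suc n) (λ i → ℕ→ℚ i * t i) ≡ (deriv f ⊛ g) n
  left = begin
    sumTo (suc n) (λ i → ℕ→ℚ i * t i)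
      ≡⟨ sumTo-peel n _ ⟩
    0ℚ * t 0 + sumTo n (λ i → ℕ→ℚ (suc i) * t (suc i))
      ≡⟨ cong (_+ sumTo n (λ i → ℕ→ℚ (suc i) * t (suc i))) (QP.*-zeroˡ (t 0)) ⟩
    0ℚ + sumTo n (λ i → ℕ→ℚ (suc i) * t (suc i))
      ≡⟨ QP.+-identityˡ _ ⟩
    sumTo n (λ i → ℕ→ℚ (suc i) * t (suc i))
      ≡⟨ sumTo-cong n (λ i _ → sym (QP.*-assoc (ℕ→ℚ (suc i)) (f (suc i)) (g (n ∸ i)))) ⟩
    (deriv f ⊛ g) n ∎
  -- the i = n+1 term has weight 0; the others give f i (deriv g)(n-i)
  right : sumTo (suc n) (λ i → ℕ→ℚ (suc n ∸ i) * t i) ≡ (f ⊛ deriv g) n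
  right = begin
    sumTo n (λ i → ℕ→ℚ (suc n ∸ i) * t i) + ℕ→ℚ (suc n ∸ suc n) * t (suc n)
      ≡⟨ cong₂ _+_ (sumTo-cong n shifted) last ⟩
    (f ⊛ deriv g) n + 0ℚ
      ≡⟨ QP.+-identityʳ _ ⟩
    (f ⊛ deriv g) n ∎
    where
    shifted : ∀ i → i ≤ n → ℕ→ℚ (suc n ∸ i) * t i ≡ f i * deriv g (n ∸ i)
    shifted i i≤n = trans (cong (λ z → ℕ→ℚ z * (f i * g z)) (NP.+-∸-assoc 1 i≤n))
      (solve 3 (λ a x y → a :* (x :* y) := x :* (a :* y)) refl (ℕ→ℚ (suc (n ∸ i))) (f i) (g (suc (n ∸ i))))
    last : ℕ→ℚ (suc n ∸ suc n) * t (suc n) ≡ 0ℚ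
    last = trans (cong (λ z → ℕ→ℚ z * t (suc n)) (NP.n∸n≡0 n)) (QP.*-zeroˡ (t (suc n)))

powS-order : ∀ (u : FPS) → u 0 ≡ 0ℚ → ∀ m k → k < m → powS u m k ≡ 0ℚ
powS-order u u₀ (suc m) k k<1+m = sumTo-zero k _ term
  where
  term : ∀ i → i ≤ k → u i * powS u m (k ∸ i) ≡ 0ℚ
  term zero    _   = trans (cong (_* powS u m k) u₀) (QP.*-zeroˡ (powS u m k))
  term (suc i) i≤k = trans (cong (u (suc i) *_) (powS-order u u₀ m (k ∸ suc i) k∸i<m))
                           (QP.*-zeroʳ (u (suc i)))
    where
    k∸i<m : k ∸ suc i < m
    k∸i<m = NP.<-≤-trans (NP.∸-monoʳ-< {k} {suc i} {0} (s≤s z≤n) i≤k) (NP.≤-pred k<1+m)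

compose-cong : ∀ {a b : ℕ → ℚ} (u : FPS) → (∀ m → a m ≡ b m) → ∀ n → compose a u n ≡ compose b u n
compose-cong u e n = sumTo-cong n (λ m _ → cong (_* powS u m n) (e m))

compose-+ : ∀ (a b : ℕ → ℚ) (u : FPS) n → compose (λ m → a m + b m) u n ≡ compose a u n + compose b u n
compose-+ a b u n = trans (sumTo-cong n (λ m _ → QP.*-distribʳ-+ (powS u m n) (a m) (b m))) (sumTo-+ n _ _)

compose-* : ∀ c (a : ℕ → ℚ) (u : FPS) n → compose (λ m → c * a m) u n ≡ c * compose a u n
compose-* c a u n = trans (sumTo-cong n (λ m _ → QP.*-assoc c (a m) (powS u m n))) (sumTo-*ˡ n c _)

-- (a ∘ u) ∘ v = Σ_m a_m (u^m ∘ v) when u has no constant term: exchange the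
-- finite sums after extending the inner ones to a common range by zeros.
compose-expand : ∀ (a : ℕ → ℚ) (u v : FPS) → u 0 ≡ 0ℚ → ∀ n →
                 compose (compose a u) v n ≡ sumTo n (λ m → a m * compose (powS u m) v n)
compose-expand a u v u₀ n = begin
  sumTo n (λ k → sumTo k (λ m → a m * powS u m k) * powS v k n)
    ≡⟨ sumTo-cong n (λ k k≤n → cong (_* powS v k n) (sym (sumTo-extend _ k≤n (λ m k<m →
         trans (cong (a m *_) (powS-order u u₀ m k k<m)) (QP.*-zeroʳ (a m)))))) ⟩
  sumTo n (λ k → sumTo n (λ m → a m * powS u m k) * powS v k n)
    ≡⟨ sumTo-cong n (λ k _ → sym (sumTo-*ʳ n (powS v k n) (λ m → a m * powS u m k))) ⟩
  sumTo n (λ k → sumTo n (λ m → a m * powS u m k * powS v k n))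
    ≡⟨ sumTo-swap n n (λ k m → a m * powS u m k * powS v k n) ⟩
  sumTo n (λ m → sumTo n (λ k → a m * powS u m k * powS v k n))
    ≡⟨ sumTo-cong n (λ m _ → trans (sumTo-cong n (λ k _ → QP.*-assoc (a m) (powS u m k) (powS v k n)))
                                   (sumTo-*ˡ n (a m) (λ k → powS u m k * powS v k n))) ⟩
  sumTo n (λ m → a m * compose (powS u m) v n) ∎

-- The Euler operator: eulerOp f n is the coefficient of tⁿ in (1+t) f'.
eulerOp : FPS → FPS
eulerOp f n = ℕ→ℚ (suc n) * f (suc n) + ℕ→ℚ n * f n

onePlusT : FPS → FPS
onePlusT f n = f n + mulT f n

onePlusT-deriv : ∀ (f : FPS) n → onePlusT (deriv f) n ≡ eulerOp f n
onePlusT-deriv f zero    = cong (λ z → deriv f 0 + z) (sym (QP.*-zeroˡ (f 0)))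
onePlusT-deriv f (suc n) = refl

eulerOp-oneS : ∀ n → eulerOp oneS n ≡ 0ℚ
eulerOp-oneS zero    = refl
eulerOp-oneS (suc n) = cong₂ _+_ (QP.*-zeroʳ (ℕ→ℚ (suc (suc n)))) (QP.*-zeroʳ (ℕ→ℚ (suc n)))

-- For u without constant term, the Euler operator passes through the sum defining
-- a ∘ u; the extra term a_{n+1} u^{n+1} in the (n+1)-st coefficient contributes
-- nothing to the n-th one.
eulerOp-compose : ∀ (a : ℕ → ℚ) (u : FPS) → u 0 ≡ 0ℚ → ∀ n →
                  eulerOp (compose a u) n ≡ sumTo (suc n) (λ k → a k * eulerOp (powS u k) n)
eulerOp-compose a u u₀ n = begin
  N₁ * sumTo (suc n) A + N₀ * sumTo n B
    ≡⟨ cong (λ z → N₁ * sumTo (suc n) A + N₀ * z) (sym extend) ⟩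
  N₁ * sumTo (suc n) A + N₀ * sumTo (suc n) B
    ≡⟨ sym (cong₂ _+_ (sumTo-*ˡ (suc n) N₁ A) (sumTo-*ˡ (suc n) N₀ B)) ⟩
  sumTo (suc n) (λ k → N₁ * A k) + sumTo (suc n) (λ k → N₀ * B k)
    ≡⟨ sym (sumTo-+ (suc n) _ _) ⟩
  sumTo (suc n) (λ k → N₁ * A k + N₀ * B k)
    ≡⟨ sumTo-cong (suc n) (λ k _ → solve 5 (λ n₁ n₀ x y z → n₁ :* (x :* y) :+ n₀ :* (x :* z)
                                                 := x :* (n₁ :* y :+ n₀ :* z))
                                      refl N₁ N₀ (a k) (powS u k (suc n)) (powS u k n)) ⟩
  sumTo (suc n) (λ k → a k * eulerOp (powS u k) n) ∎
  where
  N₁ = ℕ→ℚ (suc n) ; N₀ = ℕ→ℚ n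
  A B : ℕ → ℚ
  A k = a k * powS u k (suc n)
  B k = a k * powS u k n
  extend : sumTo (suc n) B ≡ sumTo n B
  extend = sumTo-extend B (NP.n≤1+n n)
             (λ k n<k → trans (cong (a k *_) (powS-order u u₀ k n n<k)) (QP.*-zeroʳ (a k)))

-- A series is determined by its constant term and a recurrence expressing its
-- Euler operator through its current coefficient: (n+1) f(n+1) = eulerOp f n - n f(n).
eulerOp-unique : ∀ (f g : FPS) → f 0 ≡ g 0 → (∀ n → f n ≡ g n → eulerOp f n ≡ eulerOp g n) →
                 ∀ n → f n ≡ g n
eulerOp-unique f g base step zero    = base
eulerOp-unique f g base step (suc n) = ℕ→ℚ-cancel n (+-cancelʳ (ℕ→ℚ n * f n) _ _ same)
  where
  fn≡gn = eulerOp-unique f g base step n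
  same : ℕ→ℚ (suc n) * f (suc n) + ℕ→ℚ n * f n ≡ ℕ→ℚ (suc n) * g (suc n) + ℕ→ℚ n * f n
  same = trans (step n fn≡gn) (cong (λ z → ℕ→ℚ (suc n) * g (suc n) + ℕ→ℚ n * z) (sym fn≡gn))

-- The logarithm L = log(1+t) satisfies (1+t) L' = 1, and hence
-- (1+t) (L^{k+1})' = (k+1) L^k.  This yields the chain rule (1+t)(f∘L)' = f'∘L.

deriv-log : ∀ n → deriv logS n ≡ sgn n
deriv-log n = begin
  N * (sgn n * I) ≡⟨ solve 3 (λ a b c → a :* (b :* c) := b :* (c :* a)) refl N (sgn n) I ⟩
  sgn n * (I * N) ≡⟨ cong (sgn n *_) (ℕ→ℚ-inverse (suc n)) ⟩
  sgn n * 1ℚ      ≡⟨ QP.*-identityʳ (sgn n) ⟩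
  sgn n           ∎
  where N = ℕ→ℚ (suc n) ; I = + 1 / suc n

onePlusT-deriv-log : ∀ n → onePlusT (deriv logS) n ≡ oneS n
onePlusT-deriv-log zero    = trans (QP.+-identityʳ (deriv logS 0)) (deriv-log 0)
onePlusT-deriv-log (suc n) = trans (cong₂ _+_ (deriv-log (suc n)) (deriv-log n)) (QP.+-inverseˡ (sgn n))

-- (1+t)(L·X)' = X + L·(1+t)X', by the Leibniz rule and (1+t)L' = 1.
onePlusT-deriv-log⊛ : ∀ (X : FPS) n → onePlusT (deriv (logS ⊛ X)) n ≡ X n + (logS ⊛ onePlusT (deriv X)) n
onePlusT-deriv-log⊛ X n = begin
  deriv (L ⊛ X) n + mulT (deriv (L ⊛ X)) n
    ≡⟨ cong₂ _+_ (deriv-⊛ L X n) (trans (mulT-cong (deriv-⊛ L X) n) (mulT-+ (L′ ⊛ X) (L ⊛ X′) n)) ⟩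
  ((L′ ⊛ X) n + (L ⊛ X′) n) + (mulT (L′ ⊛ X) n + mulT (L ⊛ X′) n)
    ≡⟨ cong₂ (λ a b → ((L′ ⊛ X) n + (L ⊛ X′) n) + (a + b)) (sym (mulT-⊛ˡ L′ X n)) (sym (mulT-⊛ʳ L X′ n)) ⟩
  ((L′ ⊛ X) n + (L ⊛ X′) n) + ((mulT L′ ⊛ X) n + (L ⊛ mulT X′) n)
    ≡⟨ solve 4 (λ a b c d → (a :+ b) :+ (c :+ d) := (a :+ c) :+ (b :+ d)) refl
         ((L′ ⊛ X) n) ((L ⊛ X′) n) ((mulT L′ ⊛ X) n) ((L ⊛ mulT X′) n) ⟩
  ((L′ ⊛ X) n + (mulT L′ ⊛ X) n) + ((L ⊛ X′) n + (L ⊛ mulT X′) n)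
    ≡⟨ cong₂ _+_ (sym (⊛-+ˡ L′ (mulT L′) X n)) (sym (⊛-+ʳ L X′ (mulT X′) n)) ⟩
  (onePlusT L′ ⊛ X) n + (L ⊛ onePlusT X′) n
    ≡⟨ cong (_+ (L ⊛ onePlusT X′) n) (trans (⊛-congˡ X onePlusT-deriv-log n) (oneS-⊛ X n)) ⟩
  X n + (L ⊛ onePlusT X′) n ∎
  where L = logS ; L′ = deriv logS ; X′ = deriv X

logPow-ode : ∀ k n → onePlusT (deriv (powS logS (suc k))) n ≡ ℕ→ℚ (suc k) * powS logS k n
logPow-ode zero n = begin
  onePlusT (deriv (logS ⊛ oneS)) n               ≡⟨ onePlusT-deriv-log⊛ oneS n ⟩
  oneS n + (logS ⊛ onePlusT (deriv oneS)) n      ≡⟨ cong (λ z → oneS n + z) (⊛-zeroʳ logS _ constant n) ⟩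
  oneS n + 0ℚ                                    ≡⟨ QP.+-identityʳ (oneS n) ⟩
  oneS n                                         ≡⟨ sym (QP.*-identityˡ (oneS n)) ⟩
  1ℚ * oneS n                                    ∎
  where
  constant : ∀ m → onePlusT (deriv oneS) m ≡ 0ℚ
  constant m = trans (onePlusT-deriv oneS m) (eulerOp-oneS m)
logPow-ode (suc k) n = begin
  onePlusT (deriv (logS ⊛ W₁)) n
    ≡⟨ onePlusT-deriv-log⊛ W₁ n ⟩
  W₁ n + (logS ⊛ onePlusT (deriv W₁)) n
    ≡⟨ cong (λ z → W₁ n + z) (trans (⊛-congʳ logS (logPow-ode k) n) (⊛-*ʳ M logS (powS logS k) n)) ⟩
  W₁ n + M * W₁ n
    ≡⟨ solve 2 (λ a m → a :+ m :* a := (con 1ℚ :+ m) :* a) refl (W₁ n) M ⟩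
  (1ℚ + M) * W₁ n
    ≡⟨ cong (_* W₁ n) (sym (ℕ→ℚ-suc (suc k))) ⟩
  ℕ→ℚ (suc (suc k)) * W₁ n ∎
  where W₁ = powS logS (suc k) ; M = ℕ→ℚ (suc k)

compose-log-chain : ∀ (f : ℕ → ℚ) n → eulerOp (compose f logS) n ≡ compose (deriv f) logS n
compose-log-chain f n = begin
  eulerOp (compose f logS) n
    ≡⟨ eulerOp-compose f logS refl n ⟩
  sumTo (suc n) (λ k → f k * eulerOp (powS logS k) n)
    ≡⟨ sumTo-peel n _ ⟩
  f 0 * eulerOp oneS n + sumTo n (λ k → f (suc k) * eulerOp (powS logS (suc k)) n)
    ≡⟨ cong₂ _+_ (trans (cong (f 0 *_) (eulerOp-oneS n)) (QP.*-zeroʳ (f 0)))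
                 (sumTo-cong n (λ k _ → trans (cong (f (suc k) *_) (logPow k))
                                              (reassoc (f (suc k)) (ℕ→ℚ (suc k)) (powS logS k n)))) ⟩
  0ℚ + compose (deriv f) logS n
    ≡⟨ QP.+-identityˡ _ ⟩
  compose (deriv f) logS n ∎
  where
  logPow : ∀ k → eulerOp (powS logS (suc k)) n ≡ ℕ→ℚ (suc k) * powS logS k n
  logPow k = trans (sym (onePlusT-deriv (powS logS (suc k)) n)) (logPow-ode k n)
  reassoc : ∀ a b c → a * (b * c) ≡ b * a * c
  reassoc = solve 3 (λ a b c → a :* (b :* c) := b :* a :* c) refl

-- The series u = (eᵗ-1)/2 satisfies u' = u + 1/2, hence
-- (u^{m+1})' = (m+1)(u^{m+1} + u^m/2).

half : ℚ
half = + 1 / 2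

deriv-eulerU : ∀ n → deriv eulerU n ≡ eulerU n + half * oneS n
deriv-eulerU n = begin
  N * (half * inv! (suc n)) ≡⟨ solve 3 (λ a b c → a :* (b :* c) := b :* (c :* a)) refl N half (inv! (suc n)) ⟩
  half * (inv! (suc n) * N) ≡⟨ cong (half *_) (inv!-suc n) ⟩
  half * inv! n             ≡⟨ constantTerm n ⟩
  eulerU n + half * oneS n  ∎
  where
  N = ℕ→ℚ (suc n)
  constantTerm : ∀ n → half * inv! n ≡ eulerU n + half * oneS n
  constantTerm zero    = refl
  constantTerm (suc n) = sym (trans (cong (λ z → eulerU (suc n) + z) (QP.*-zeroʳ half)) (QP.+-identityʳ _))

eulerPow-deriv : ∀ m n → deriv (powS eulerU (suc m)) n
                         ≡ ℕ→ℚ (suc m) * (powS eulerU (suc m) n + half * powS eulerU m n)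
eulerPow-deriv zero n = begin
  deriv (eulerU ⊛ oneS) n
    ≡⟨ deriv-⊛ eulerU oneS n ⟩
  (deriv eulerU ⊛ oneS) n + (eulerU ⊛ deriv oneS) n
    ≡⟨ cong₂ _+_ (⊛-oneS (deriv eulerU) n) (⊛-zeroʳ eulerU (deriv oneS) (λ k → QP.*-zeroʳ (ℕ→ℚ (suc k))) n) ⟩
  deriv eulerU n + 0ℚ
    ≡⟨ trans (QP.+-identityʳ (deriv eulerU n)) (deriv-eulerU n) ⟩
  eulerU n + half * oneS n
    ≡⟨ cong (λ z → z + half * oneS n) (sym (⊛-oneS eulerU n)) ⟩
  (eulerU ⊛ oneS) n + half * oneS n
    ≡⟨ sym (QP.*-identityˡ _) ⟩
  1ℚ * ((eulerU ⊛ oneS) n + half * oneS n) ∎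
eulerPow-deriv (suc m) n = begin
  deriv (eulerU ⊛ X) n
    ≡⟨ deriv-⊛ eulerU X n ⟩
  (deriv eulerU ⊛ X) n + (eulerU ⊛ deriv X) n
    ≡⟨ cong₂ _+_ first second ⟩
  (a + half * b) + M * (a + half * b)
    ≡⟨ solve 2 (λ x m → x :+ m :* x := (con 1ℚ :+ m) :* x) refl (a + half * b) M ⟩
  (1ℚ + M) * (a + half * b)
    ≡⟨ cong (_* (a + half * b)) (sym (ℕ→ℚ-suc (suc m))) ⟩
  ℕ→ℚ (suc (suc m)) * (a + half * b) ∎
  where
  X = powS eulerU (suc m) ; M = ℕ→ℚ (suc m)
  a = powS eulerU (suc (suc m)) n ; b = X n
  halfPrev : FPS
  halfPrev k = half * powS eulerU m k
  first : (deriv eulerU ⊛ X) n ≡ a + half * b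
  first = begin
    (deriv eulerU ⊛ X) n                        ≡⟨ ⊛-congˡ X deriv-eulerU n ⟩
    ((λ k → eulerU k + half * oneS k) ⊛ X) n    ≡⟨ ⊛-+ˡ eulerU (λ k → half * oneS k) X n ⟩
    a + ((λ k → half * oneS k) ⊛ X) n           ≡⟨ cong (λ z → a + z) (⊛-*ˡ half oneS X n) ⟩
    a + half * (oneS ⊛ X) n                     ≡⟨ cong (λ z → a + half * z) (oneS-⊛ X n) ⟩
    a + half * b                                ∎
  second : (eulerU ⊛ deriv X) n ≡ M * (a + half * b)
  second = begin
    (eulerU ⊛ deriv X) n                          ≡⟨ ⊛-congʳ eulerU (eulerPow-deriv m) n ⟩
    (eulerU ⊛ (λ k → M * (X k + halfPrev k))) n   ≡⟨ ⊛-*ʳ M eulerU (λ k → X k + halfPrev k) n ⟩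
    M * (eulerU ⊛ (λ k → X k + halfPrev k)) n     ≡⟨ cong (M *_) (⊛-+ʳ eulerU X halfPrev n) ⟩
    M * (a + (eulerU ⊛ halfPrev) n)               ≡⟨ cong (λ z → M * (a + z)) (⊛-*ʳ half eulerU (powS eulerU m) n) ⟩
    M * (a + half * b)                            ∎

-- u ∘ L = t/2, in the form  u^m ∘ L = (t/2)^m.  The coefficients of (t/2)^m:
halfPow : ℕ → ℚ
halfPow zero    = 1ℚ
halfPow (suc m) = half * halfPow m

halfMono : ℕ → FPS
halfMono m n with m ℕ.≟ n
... | yes _ = halfPow m
... | no  _ = 0ℚ

halfMono-diag : ∀ m → halfMono m m ≡ halfPow m
halfMono-diag m with m ℕ.≟ m
... | yes _   = refl
... | no  m≢m = ⊥-elim (m≢m refl)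

halfMono-off : ∀ m n → ¬ m ≡ n → halfMono m n ≡ 0ℚ
halfMono-off m n m≢n with m ℕ.≟ n
... | yes m≡n = ⊥-elim (m≢n m≡n)
... | no  _   = refl

-- (t/2)^{m+1} satisfies the same differential equation as u^{m+1} ∘ L:
-- (1+t)((t/2)^{m+1})' = (m+1)((t/2)^{m+1} + (t/2)^m/2).
halfMono-ode : ∀ m n → eulerOp (halfMono (suc m)) n
                       ≡ ℕ→ℚ (suc m) * (halfMono (suc m) n + half * halfMono m n)
halfMono-ode m n = byCases (m ℕ.≟ n) (suc m ℕ.≟ n)
  where
  Goal = eulerOp (halfMono (suc m)) n ≡ ℕ→ℚ (suc m) * (halfMono (suc m) n + half * halfMono m n)
  byCases : Dec (m ≡ n) → Dec (suc m ≡ n) → Goal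
  byCases (yes refl) _ = begin
    N₁ * halfMono (suc m) (suc m) + N₀ * halfMono (suc m) m
      ≡⟨ cong₂ (λ x y → N₁ * x + N₀ * y) (halfMono-diag (suc m)) (halfMono-off (suc m) m NP.1+n≢n) ⟩
    N₁ * (half * halfPow m) + N₀ * 0ℚ
      ≡⟨ solve 3 (λ a b p → a :* (con half :* p) :+ b :* con 0ℚ := a :* (con 0ℚ :+ con half :* p))
               refl N₁ N₀ (halfPow m) ⟩
    N₁ * (0ℚ + half * halfPow m)
      ≡⟨ cong₂ (λ x y → N₁ * (x + half * y)) (sym (halfMono-off (suc m) m NP.1+n≢n)) (sym (halfMono-diag m)) ⟩
    N₁ * (halfMono (suc m) m + half * halfMono m m) ∎
    where N₁ = ℕ→ℚ (suc m) ; N₀ = ℕ→ℚ m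
  byCases (no m≢n) (yes refl) = begin
    N₁ * halfMono (suc m) (suc (suc m)) + N₀ * halfMono (suc m) (suc m)
      ≡⟨ cong₂ (λ x y → N₁ * x + N₀ * y)
               (halfMono-off (suc m) (suc (suc m)) (NP.1+n≢n ∘ sym)) (halfMono-diag (suc m)) ⟩
    N₁ * 0ℚ + N₀ * halfPow (suc m)
      ≡⟨ solve 3 (λ a b p → a :* con 0ℚ :+ b :* p := b :* (p :+ con half :* con 0ℚ))
               refl N₁ N₀ (halfPow (suc m)) ⟩
    N₀ * (halfPow (suc m) + half * 0ℚ)
      ≡⟨ cong₂ (λ x y → N₀ * (x + half * y)) (sym (halfMono-diag (suc m))) (sym (halfMono-off m (suc m) m≢n)) ⟩
    N₀ * (halfMono (suc m) (suc m) + half * halfMono m (suc m)) ∎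
    where N₁ = ℕ→ℚ (suc (suc m)) ; N₀ = ℕ→ℚ (suc m)
  byCases (no m≢n) (no 1+m≢n) = begin
    N₁ * halfMono (suc m) (suc n) + N₀ * halfMono (suc m) n
      ≡⟨ cong₂ (λ x y → N₁ * x + N₀ * y)
               (halfMono-off (suc m) (suc n) (m≢n ∘ NP.suc-injective)) (halfMono-off (suc m) n 1+m≢n) ⟩
    N₁ * 0ℚ + N₀ * 0ℚ
      ≡⟨ solve 3 (λ a b c → a :* con 0ℚ :+ b :* con 0ℚ := c :* (con 0ℚ :+ con half :* con 0ℚ))
               refl N₁ N₀ M ⟩
    M * (0ℚ + half * 0ℚ)
      ≡⟨ cong₂ (λ x y → M * (x + half * y))
               (sym (halfMono-off (suc m) n 1+m≢n)) (sym (halfMono-off m n m≢n)) ⟩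
    M * (halfMono (suc m) n + half * halfMono m n) ∎
    where N₁ = ℕ→ℚ (suc n) ; N₀ = ℕ→ℚ n ; M = ℕ→ℚ (suc m)

-- u^m ∘ L = (t/2)^m: for m = 0 both sides are 1; for m+1 both sides vanish at
-- t = 0 and satisfy the same recurrence, by the chain rule and eulerPow-deriv.
eulerPow∘log : ∀ m n → compose (powS eulerU m) logS n ≡ halfMono m n
eulerPow∘log zero n = begin
  compose oneS logS n                  ≡⟨ sumTo-single n 0 _ z≤n higher ⟩
  1ℚ * oneS n                          ≡⟨ QP.*-identityˡ (oneS n) ⟩
  oneS n                               ≡⟨ oneS≡halfMono n ⟩
  halfMono 0 n                         ∎
  where
  higher : ∀ k → k ≤ n → ¬ k ≡ 0 → oneS k * powS logS k n ≡ 0ℚ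
  higher zero    _ k≢0 = ⊥-elim (k≢0 refl)
  higher (suc k) _ _   = QP.*-zeroˡ (powS logS (suc k) n)
  oneS≡halfMono : ∀ n → oneS n ≡ halfMono 0 n
  oneS≡halfMono zero    = sym (halfMono-diag 0)
  oneS≡halfMono (suc n) = sym (halfMono-off 0 (suc n) (λ ()))
eulerPow∘log (suc m) = eulerOp-unique (compose U logS) (halfMono (suc m)) base step
  where
  U = powS eulerU (suc m) ; M = ℕ→ℚ (suc m)
  base : compose U logS 0 ≡ halfMono (suc m) 0
  base = trans (cong (_* 1ℚ) (powS-order eulerU refl (suc m) 0 (s≤s z≤n)))
               (sym (halfMono-off (suc m) 0 (λ ())))
  step : ∀ n → compose U logS n ≡ halfMono (suc m) n →
         eulerOp (compose U logS) n ≡ eulerOp (halfMono (suc m)) n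
  step n same = begin
    eulerOp (compose U logS) n
      ≡⟨ compose-log-chain U n ⟩
    compose (deriv U) logS n
      ≡⟨ compose-cong logS (eulerPow-deriv m) n ⟩
    compose (λ k → M * (U k + half * powS eulerU m k)) logS n
      ≡⟨ compose-* M _ logS n ⟩
    M * compose (λ k → U k + half * powS eulerU m k) logS n
      ≡⟨ cong (M *_) (compose-+ U _ logS n) ⟩
    M * (compose U logS n + compose (λ k → half * powS eulerU m k) logS n)
      ≡⟨ cong (λ z → M * (compose U logS n + z)) (compose-* half (powS eulerU m) logS n) ⟩
    M * (compose U logS n + half * compose (powS eulerU m) logS n)
      ≡⟨ cong₂ (λ x y → M * (x + half * y)) same (eulerPow∘log m n) ⟩
    M * (halfMono (suc m) n + half * halfMono m n)
      ≡⟨ sym (halfMono-ode m n) ⟩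
    eulerOp (halfMono (suc m)) n ∎

-- Σ_k s(n,k) E_k = n! (-1/2)ⁿ.  Up to the factor n!, the sum is
-- ((Σ_m (-1)^m X^m) ∘ u) ∘ L = Σ_m (-1)^m (u^m ∘ L) = Σ_m (-1)^m (t/2)^m at tⁿ.
stirlingEuler-sum : ∀ n → sumTo n (λ k → s n k * E k) ≡ ℕ→ℚ (n !) * (sgn n * halfPow n)
stirlingEuler-sum n = begin
  sumTo n (λ k → s n k * E k)
    ≡⟨ sumTo-cong n (λ k _ → factor k) ⟩
  sumTo n (λ k → F * (compose sgn eulerU k * powS logS k n))
    ≡⟨ sumTo-*ˡ n F _ ⟩
  F * compose (compose sgn eulerU) logS n
    ≡⟨ cong (F *_) (compose-expand sgn eulerU logS refl n) ⟩
  F * sumTo n (λ m → sgn m * compose (powS eulerU m) logS n)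
    ≡⟨ cong (F *_) (sumTo-cong n (λ m _ → cong (sgn m *_) (eulerPow∘log m n))) ⟩
  F * sumTo n (λ m → sgn m * halfMono m n)
    ≡⟨ cong (F *_) (sumTo-single n n _ NP.≤-refl offDiagonal) ⟩
  F * (sgn n * halfMono n n)
    ≡⟨ cong (λ z → F * (sgn n * z)) (halfMono-diag n) ⟩
  F * (sgn n * halfPow n) ∎
  where
  F = ℕ→ℚ (n !)
  offDiagonal : ∀ m → m ≤ n → ¬ m ≡ n → sgn m * halfMono m n ≡ 0ℚ
  offDiagonal m _ m≢n = trans (cong (sgn m *_) (halfMono-off m n m≢n)) (QP.*-zeroʳ (sgn m))
  -- s(n,k) E_k = n! [tⁿ]L^k · (1/k!) · k! a_k  with a_k = [t^k] Σ_m (-1)^m u^m.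
  factor : ∀ k → s n k * E k ≡ F * (compose sgn eulerU k * powS logS k n)
  factor k = begin
    F * (w * I) * (K * a)    ≡⟨ solve 5 (λ F w I K a → F :* (w :* I) :* (K :* a) := F :* (a :* w) :* (I :* K))
                                         refl F w I K a ⟩
    F * (a * w) * (I * K)    ≡⟨ cong (F * (a * w) *_) (inv!-inverse k) ⟩
    F * (a * w) * 1ℚ         ≡⟨ QP.*-identityʳ _ ⟩
    F * (a * w)              ∎
    where w = powS logS k n ; I = inv! k ; K = ℕ→ℚ (k !) ; a = compose sgn eulerU k

-- Σ_k (-1)^k C(n,k)² is the coefficient of tⁿ in (1-t)ⁿ(1+t)ⁿ = (1-t²)ⁿ.

binomS : ℕ → FPS
binomS n k = ℕ→ℚ (n C k)

altBinomS : ℕ → FPS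
altBinomS n k = sgn k * binomS n k

squareDiffS : ℕ → FPS
squareDiffS n = altBinomS n ⊛ binomS n

oneMinusT : FPS → FPS
oneMinusT f n = f n + - mulT f n

binomS-pascal : ∀ n k → binomS (suc n) k ≡ onePlusT (binomS n) k
binomS-pascal n zero    = refl
binomS-pascal n (suc k) = begin
  ℕ→ℚ (suc n C suc k)                 ≡⟨ cong ℕ→ℚ (sym (nCk+nC[k+1]≡[n+1]C[k+1] n k)) ⟩
  ℕ→ℚ (n C k ℕ.+ n C suc k)           ≡⟨ cong ℕ→ℚ (NP.+-comm (n C k) (n C suc k)) ⟩
  ℕ→ℚ (n C suc k ℕ.+ n C k)           ≡⟨ ℕ→ℚ-+ (n C suc k) (n C k) ⟩
  ℕ→ℚ (n C suc k) + ℕ→ℚ (n C k)       ∎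

altBinomS-pascal : ∀ n k → altBinomS (suc n) k ≡ oneMinusT (altBinomS n) k
altBinomS-pascal n zero    = cong (sgn 0 *_) (binomS-pascal n 0)
altBinomS-pascal n (suc k) = trans (cong (sgn (suc k) *_) (binomS-pascal n (suc k)))
  (solve 3 (λ s a b → (:- s) :* (a :+ b) := (:- s) :* a :+ :- (s :* b)) refl (sgn k) (binomS n (suc k)) (binomS n k))

⊛-negˡ : ∀ (f g : FPS) n → ((λ k → - f k) ⊛ g) n ≡ - (f ⊛ g) n
⊛-negˡ f g n = begin
  ((λ k → - f k) ⊛ g) n        ≡⟨ ⊛-congˡ g (λ k → neg≡-1* (f k)) n ⟩
  ((λ k → - 1ℚ * f k) ⊛ g) n   ≡⟨ ⊛-*ˡ (- 1ℚ) f g n ⟩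
  - 1ℚ * (f ⊛ g) n             ≡⟨ sym (neg≡-1* _) ⟩
  - (f ⊛ g) n                  ∎
  where
  neg≡-1* : ∀ x → - x ≡ - 1ℚ * x
  neg≡-1* = solve 1 (λ x → :- x := :- con 1ℚ :* x) refl

oneMinusT-⊛-onePlusT : ∀ (f g : FPS) n →
  (oneMinusT f ⊛ onePlusT g) n ≡ (f ⊛ g) n + - mulT (mulT (f ⊛ g)) n
oneMinusT-⊛-onePlusT f g n = begin
  (oneMinusT f ⊛ onePlusT g) n
    ≡⟨ ⊛-+ˡ f (λ k → - mulT f k) (onePlusT g) n ⟩
  (f ⊛ onePlusT g) n + ((λ k → - mulT f k) ⊛ onePlusT g) n
    ≡⟨ cong₂ _+_ (⊛-+ʳ f g (mulT g) n)
                 (trans (⊛-negˡ (mulT f) (onePlusT g) n) (cong -_ (⊛-+ʳ (mulT f) g (mulT g) n))) ⟩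
  ((f ⊛ g) n + (f ⊛ mulT g) n) + - ((mulT f ⊛ g) n + (mulT f ⊛ mulT g) n)
    ≡⟨ cong₂ (λ x y → ((f ⊛ g) n + x) + - y) (mulT-⊛ʳ f g n)
             (cong₂ _+_ (mulT-⊛ˡ f g n) (trans (mulT-⊛ˡ f (mulT g) n) (mulT-cong (mulT-⊛ʳ f g) n))) ⟩
  (c + mulT (f ⊛ g) n) + - (mulT (f ⊛ g) n + mulT (mulT (f ⊛ g)) n)
    ≡⟨ solve 3 (λ c s t → (c :+ s) :+ :- (s :+ t) := c :+ :- t)
               refl c (mulT (f ⊛ g) n) (mulT (mulT (f ⊛ g)) n) ⟩
  c + - mulT (mulT (f ⊛ g)) n ∎
  where c = (f ⊛ g) n

squareDiffS-step : ∀ n k → squareDiffS (suc n) k ≡ squareDiffS n k + - mulT (mulT (squareDiffS n)) k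
squareDiffS-step n k = begin
  (altBinomS (suc n) ⊛ binomS (suc n)) k         ≡⟨ ⊛-congˡ (binomS (suc n)) (altBinomS-pascal n) k ⟩
  (oneMinusT (altBinomS n) ⊛ binomS (suc n)) k   ≡⟨ ⊛-congʳ (oneMinusT (altBinomS n)) (binomS-pascal n) k ⟩
  (oneMinusT (altBinomS n) ⊛ onePlusT (binomS n)) k
                                                 ≡⟨ oneMinusT-⊛-onePlusT (altBinomS n) (binomS n) k ⟩
  squareDiffS n k + - mulT (mulT (squareDiffS n)) k ∎

squareDiffS-zero : ∀ k → squareDiffS 0 k ≡ oneS k
squareDiffS-zero k = trans (⊛-congˡ (binomS 0) alt0 k) (trans (⊛-congʳ oneS bin0 k) (oneS-⊛ oneS k))
  where
  bin0 : ∀ j → binomS 0 j ≡ oneS j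
  bin0 zero    = refl
  bin0 (suc j) = refl
  alt0 : ∀ j → altBinomS 0 j ≡ oneS j
  alt0 zero    = refl
  alt0 (suc j) = QP.*-zeroʳ (sgn (suc j))

squareDiffS-even : ∀ n i → squareDiffS n (i ℕ.+ i) ≡ sgn i * binomS n i
squareDiffS-even zero    zero    = squareDiffS-zero 0
squareDiffS-even zero    (suc i) = trans (squareDiffS-zero (suc i ℕ.+ suc i)) (sym (QP.*-zeroʳ (sgn (suc i))))
squareDiffS-even (suc n) zero    = trans (squareDiffS-step n 0) (cong (λ z → z + - 0ℚ) (squareDiffS-even n 0))
squareDiffS-even (suc n) (suc i) = begin
  squareDiffS (suc n) (suc i ℕ.+ suc i)
    ≡⟨ cong (squareDiffS (suc n)) 2i+2 ⟩
  squareDiffS (suc n) (suc (suc (i ℕ.+ i)))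
    ≡⟨ squareDiffS-step n (suc (suc (i ℕ.+ i))) ⟩
  squareDiffS n (suc (suc (i ℕ.+ i))) + - squareDiffS n (i ℕ.+ i)
    ≡⟨ cong₂ (λ a b → a + - b) (trans (cong (squareDiffS n) (sym 2i+2)) (squareDiffS-even n (suc i)))
                               (squareDiffS-even n i) ⟩
  sgn (suc i) * binomS n (suc i) + - (sgn i * binomS n i)
    ≡⟨ solve 3 (λ s a b → (:- s) :* a :+ :- (s :* b) := (:- s) :* (a :+ b))
               refl (sgn i) (binomS n (suc i)) (binomS n i) ⟩
  sgn (suc i) * (binomS n (suc i) + binomS n i)
    ≡⟨ cong (sgn (suc i) *_) (sym (binomS-pascal n (suc i))) ⟩
  sgn (suc i) * binomS (suc n) (suc i) ∎
  where 2i+2 = cong suc (NP.+-suc i i)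

squareDiffS-odd : ∀ n i → squareDiffS n (suc (i ℕ.+ i)) ≡ 0ℚ
squareDiffS-odd zero    i       = squareDiffS-zero (suc (i ℕ.+ i))
squareDiffS-odd (suc n) zero    = trans (squareDiffS-step n 1) (cong (λ z → z + - 0ℚ) (squareDiffS-odd n 0))
squareDiffS-odd (suc n) (suc i) = begin
  squareDiffS (suc n) (suc (suc i ℕ.+ suc i))
    ≡⟨ cong (squareDiffS (suc n)) 2i+3 ⟩
  squareDiffS (suc n) (suc (suc (suc (i ℕ.+ i))))
    ≡⟨ squareDiffS-step n (suc (suc (suc (i ℕ.+ i)))) ⟩
  squareDiffS n (suc (suc (suc (i ℕ.+ i)))) + - squareDiffS n (suc (i ℕ.+ i))
    ≡⟨ cong₂ (λ a b → a + - b) (trans (cong (squareDiffS n) (sym 2i+3)) (squareDiffS-odd n (suc i)))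
                               (squareDiffS-odd n i) ⟩
  0ℚ + - 0ℚ
    ≡⟨⟩
  0ℚ ∎
  where 2i+3 = cong (λ z → suc (suc z)) (NP.+-suc i i)

-- The alternating sum of squared binomial coefficients inside y₆ is [tⁿ](1-t²)ⁿ,
-- pairing C(n,k) with C(n,n-k).
altSquareSum : ∀ n → sumTo n (λ k → sgn k * ℕ→ℚ ((n C k) ℕ.* (n C k))) ≡ squareDiffS n n
altSquareSum n = sumTo-cong n term
  where
  term : ∀ k → k ≤ n → sgn k * ℕ→ℚ ((n C k) ℕ.* (n C k)) ≡ altBinomS n k * binomS n (n ∸ k)
  term k k≤n = begin
    sgn k * ℕ→ℚ ((n C k) ℕ.* (n C k))       ≡⟨ cong (sgn k *_) (ℕ→ℚ-* (n C k) (n C k)) ⟩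
    sgn k * (binomS n k * binomS n k)       ≡⟨ cong (λ z → sgn k * (binomS n k * ℕ→ℚ z)) (nCk≡nC[n∸k] k≤n) ⟩
    sgn k * (binomS n k * binomS n (n ∸ k)) ≡⟨ sym (QP.*-assoc (sgn k) (binomS n k) (binomS n (n ∸ k))) ⟩
    altBinomS n k * binomS n (n ∸ k)        ∎

-- Legendre polynomials at 0: with u = -2·0·t + t² = t², P_n(0) = [tⁿ] Σ_m C(-1/2,m) t^{2m}.

legendreU0-⊛ : ∀ (f : FPS) n → (legendreU 0ℚ ⊛ f) (suc (suc n)) ≡ f n
legendreU0-⊛ f n = trans (sumTo-single (suc (suc n)) 2 _ (s≤s (s≤s z≤n)) others) (QP.*-identityˡ (f n))
  where
  others : ∀ i → i ≤ suc (suc n) → ¬ i ≡ 2 → legendreU 0ℚ i * f (suc (suc n) ∸ i) ≡ 0ℚ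
  others 0               _ _   = QP.*-zeroˡ (f (suc (suc n)))
  others 1               _ _   = QP.*-zeroˡ (f (suc n))
  others 2               _ i≢2 = ⊥-elim (i≢2 refl)
  others (suc (suc (suc i))) _ _ = QP.*-zeroˡ (f (suc (suc n) ∸ suc (suc (suc i))))

tSquaredPow-diag : ∀ m → powS (legendreU 0ℚ) m (m ℕ.+ m) ≡ 1ℚ
tSquaredPow-diag zero    = refl
tSquaredPow-diag (suc m) = begin
  powS (legendreU 0ℚ) (suc m) (suc (m ℕ.+ suc m))   ≡⟨ cong (powS (legendreU 0ℚ) (suc m) ∘ suc) (NP.+-suc m m) ⟩
  powS (legendreU 0ℚ) (suc m) (suc (suc (m ℕ.+ m))) ≡⟨ legendreU0-⊛ (powS (legendreU 0ℚ) m) (m ℕ.+ m) ⟩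
  powS (legendreU 0ℚ) m (m ℕ.+ m)                   ≡⟨ tSquaredPow-diag m ⟩
  1ℚ                                                ∎

tSquaredPow-off : ∀ m n → ¬ n ≡ m ℕ.+ m → powS (legendreU 0ℚ) m n ≡ 0ℚ
tSquaredPow-off zero    zero          n≢0 = ⊥-elim (n≢0 refl)
tSquaredPow-off zero    (suc n)       _   = refl
tSquaredPow-off (suc m) zero          _   = QP.*-zeroˡ (powS (legendreU 0ℚ) m 0)
tSquaredPow-off (suc m) (suc zero)    _   =
  cong₂ _+_ (QP.*-zeroˡ (powS (legendreU 0ℚ) m 1)) (QP.*-zeroˡ (powS (legendreU 0ℚ) m 0))
tSquaredPow-off (suc m) (suc (suc n)) n≢ = trans (legendreU0-⊛ (powS (legendreU 0ℚ) m) n)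
  (tSquaredPow-off m n (λ n≡2m → n≢ (trans (cong (suc ∘ suc) n≡2m) (sym (cong suc (NP.+-suc m m))))))

double-injective : ∀ {m j} → m ℕ.+ m ≡ j ℕ.+ j → m ≡ j
double-injective {m} {j} e = NP.≤-antisym
  (NP.≮⇒≥ (λ j<m → NP.<-irrefl (sym e) (NP.+-mono-< j<m j<m)))
  (NP.≮⇒≥ (λ m<j → NP.<-irrefl e (NP.+-mono-< m<j m<j)))

odd≢double : ∀ j m → ¬ suc (j ℕ.+ j) ≡ m ℕ.+ m
odd≢double j m e with NP.≤-<-connex m j
... | inj₁ m≤j = NP.<-irrefl (sym e) (s≤s (NP.+-mono-≤ m≤j m≤j))
... | inj₂ j<m = NP.<-irrefl e (subst (ℕ._≤ m ℕ.+ m) (cong suc (NP.+-suc j j)) (NP.+-mono-≤ j<m j<m))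

Legendre0-even : ∀ j → P (j ℕ.+ j) 0ℚ ≡ binomNegHalf j
Legendre0-even j = begin
  P (j ℕ.+ j) 0ℚ                                        ≡⟨ sumTo-single (j ℕ.+ j) j _ (NP.m≤m+n j j) others ⟩
  binomNegHalf j * powS (legendreU 0ℚ) j (j ℕ.+ j)      ≡⟨ cong (binomNegHalf j *_) (tSquaredPow-diag j) ⟩
  binomNegHalf j * 1ℚ                                   ≡⟨ QP.*-identityʳ (binomNegHalf j) ⟩
  binomNegHalf j                                        ∎
  where
  others : ∀ m → m ≤ j ℕ.+ j → ¬ m ≡ j → binomNegHalf m * powS (legendreU 0ℚ) m (j ℕ.+ j) ≡ 0ℚ
  others m _ m≢j = trans (cong (binomNegHalf m *_) (tSquaredPow-off m (j ℕ.+ j) (m≢j ∘ double-injective ∘ sym)))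
                         (QP.*-zeroʳ (binomNegHalf m))

Legendre0-odd : ∀ j → P (suc (j ℕ.+ j)) 0ℚ ≡ 0ℚ
Legendre0-odd j = sumTo-zero (suc (j ℕ.+ j)) _ (λ m _ →
  trans (cong (binomNegHalf m *_) (tSquaredPow-off m (suc (j ℕ.+ j)) (odd≢double j m)))
        (QP.*-zeroʳ (binomNegHalf m)))

-- C(-1/2, j) = (-1)^j C(2j,j)/4^j, from
-- (-1/2)(-3/2)⋯(-(2j-1)/2) · j! = (-1)^j (2j)! / 2^{2j}.
halfFall-factorial : ∀ j → halfFall j * ℕ→ℚ (j !) ≡ sgn j * ℕ→ℚ ((j ℕ.+ j) !) * halfPow (j ℕ.+ j)
halfFall-factorial zero    = refl
halfFall-factorial (suc j) = begin
  H * (- (half + x)) * ℕ→ℚ (suc j !)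
    ≡⟨ cong (H * (- (half + x)) *_) (trans (ℕ→ℚ-* (suc j) (j !)) (cong (_* G) (ℕ→ℚ-suc j))) ⟩
  H * (- (half + x)) * ((1ℚ + x) * G)
    ≡⟨ solve 3 (λ H x G → H :* (:- (con half :+ x)) :* ((con 1ℚ :+ x) :* G)
                        := (:- (con half :+ x)) :* (con 1ℚ :+ x) :* (H :* G)) refl H x G ⟩
  (- (half + x)) * (1ℚ + x) * (H * G)
    ≡⟨ cong ((- (half + x)) * (1ℚ + x) *_) (halfFall-factorial j) ⟩
  (- (half + x)) * (1ℚ + x) * (σ * F * Pw)
    ≡⟨ solve 4 (λ x s F Pw → (:- (con half :+ x)) :* (con 1ℚ :+ x) :* (s :* F :* Pw)
                   := (:- s) :* ((con 1ℚ :+ (con 1ℚ :+ (x :+ x))) :* ((con 1ℚ :+ (x :+ x)) :* F))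
                        :* (con half :* (con half :* Pw))) refl x σ F Pw ⟩
  (- σ) * ((1ℚ + (1ℚ + (x + x))) * ((1ℚ + (x + x)) * F)) * (half * (half * Pw))
    ≡⟨ cong (λ z → (- σ) * z * (half * (half * Pw))) (sym factorial-2j+2) ⟩
  (- σ) * ℕ→ℚ (suc (suc (j ℕ.+ j)) !) * halfPow (suc (suc (j ℕ.+ j)))
    ≡⟨ cong (λ z → (- σ) * ℕ→ℚ (z !) * halfPow z) (sym 2j+2) ⟩
  sgn (suc j) * ℕ→ℚ ((suc j ℕ.+ suc j) !) * halfPow (suc j ℕ.+ suc j) ∎
  where
  H = halfFall j ; x = ℕ→ℚ j ; G = ℕ→ℚ (j !) ; σ = sgn j ; F = ℕ→ℚ ((j ℕ.+ j) !) ; Pw = halfPow (j ℕ.+ j)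
  2j+2 : suc j ℕ.+ suc j ≡ suc (suc (j ℕ.+ j))
  2j+2 = cong suc (NP.+-suc j j)
  2j+1≡ : ℕ→ℚ (suc (j ℕ.+ j)) ≡ 1ℚ + (x + x)
  2j+1≡ = trans (ℕ→ℚ-suc (j ℕ.+ j)) (cong (λ z → 1ℚ + z) (ℕ→ℚ-+ j j))
  factorial-2j+2 : ℕ→ℚ (suc (suc (j ℕ.+ j)) !) ≡ (1ℚ + (1ℚ + (x + x))) * ((1ℚ + (x + x)) * F)
  factorial-2j+2 = begin
    ℕ→ℚ (suc (suc (j ℕ.+ j)) !)
      ≡⟨ ℕ→ℚ-* (suc (suc (j ℕ.+ j))) (suc (j ℕ.+ j) !) ⟩
    ℕ→ℚ (suc (suc (j ℕ.+ j))) * ℕ→ℚ (suc (j ℕ.+ j) !)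
      ≡⟨ cong (ℕ→ℚ (suc (suc (j ℕ.+ j))) *_) (ℕ→ℚ-* (suc (j ℕ.+ j)) ((j ℕ.+ j) !)) ⟩
    ℕ→ℚ (suc (suc (j ℕ.+ j))) * (ℕ→ℚ (suc (j ℕ.+ j)) * F)
      ≡⟨ cong₂ (λ a b → a * (b * F)) (trans (ℕ→ℚ-suc (suc (j ℕ.+ j))) (cong (λ z → 1ℚ + z) 2j+1≡)) 2j+1≡ ⟩
    (1ℚ + (1ℚ + (x + x))) * ((1ℚ + (x + x)) * F) ∎

central-binomial : ∀ j → ((j ℕ.+ j) C j) ℕ.* (j ! ℕ.* j !) ≡ (j ℕ.+ j) !
central-binomial j = begin
  ((j ℕ.+ j) C j) ℕ.* (j ! ℕ.* j !)               ≡⟨ cong (λ z → ((j ℕ.+ j) C j) ℕ.* (j ! ℕ.* z !)) (sym j≡2j∸j) ⟩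
  ((j ℕ.+ j) C j) ℕ.* (j ! ℕ.* (j ℕ.+ j ∸ j) !)   ≡⟨ cong (ℕ._* (j ! ℕ.* (j ℕ.+ j ∸ j) !)) (nCk≡n!/k![n-k]! j≤2j) ⟩
  ((j ℕ.+ j) ! DM./ (j ! ℕ.* (j ℕ.+ j ∸ j) !)) ℕ.* (j ! ℕ.* (j ℕ.+ j ∸ j) !)
                                                  ≡⟨ DM.m/n*n≡m (k![n∸k]!∣n! j≤2j) ⟩
  (j ℕ.+ j) !                                     ∎
  where
  j≤2j = NP.m≤m+n j j
  j≡2j∸j = NP.m+n∸m≡n j j
  instance _ = j NP.!* (j ℕ.+ j ∸ j) !≢0

binomNegHalf-central : ∀ j → binomNegHalf j ≡ sgn j * ℕ→ℚ ((j ℕ.+ j) C j) * halfPow (j ℕ.+ j)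
binomNegHalf-central j = begin
  H * I                               ≡⟨ sym (QP.*-identityʳ (H * I)) ⟩
  H * I * 1ℚ                          ≡⟨ cong (H * I *_) (trans (sym (inv!-inverse j)) (QP.*-comm I G)) ⟩
  H * I * (G * I)                     ≡⟨ solve 3 (λ H I G → H :* I :* (G :* I) := (H :* G) :* I :* I) refl H I G ⟩
  (H * G) * I * I                     ≡⟨ cong (λ z → z * I * I) (halfFall-factorial j) ⟩
  (σ * ℕ→ℚ ((j ℕ.+ j) !) * Pw) * I * I
                                      ≡⟨ cong (λ z → (σ * z * Pw) * I * I) factorial-2j ⟩
  (σ * (Cq * (G * G)) * Pw) * I * I    ≡⟨ solve 5 (λ σ Cq G Pw I → (σ :* (Cq :* (G :* G)) :* Pw) :* I :* I
                                                          := σ :* Cq :* Pw :* ((I :* G) :* (I :* G))) refl σ Cq G Pw I ⟩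
  σ * Cq * Pw * ((I * G) * (I * G))   ≡⟨ cong (λ z → σ * Cq * Pw * (z * z)) (inv!-inverse j) ⟩
  σ * Cq * Pw * (1ℚ * 1ℚ)             ≡⟨ QP.*-identityʳ (σ * Cq * Pw) ⟩
  σ * Cq * Pw                         ∎
  where
  H = halfFall j ; I = inv! j ; G = ℕ→ℚ (j !) ; σ = sgn j
  Pw = halfPow (j ℕ.+ j) ; Cq = ℕ→ℚ ((j ℕ.+ j) C j)
  factorial-2j : ℕ→ℚ ((j ℕ.+ j) !) ≡ Cq * (G * G)
  factorial-2j = begin
    ℕ→ℚ ((j ℕ.+ j) !)                               ≡⟨ cong ℕ→ℚ (sym (central-binomial j)) ⟩
    ℕ→ℚ (((j ℕ.+ j) C j) ℕ.* (j ! ℕ.* j !))         ≡⟨ ℕ→ℚ-* ((j ℕ.+ j) C j) (j ! ℕ.* j !) ⟩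
    Cq * ℕ→ℚ (j ! ℕ.* j !)                          ≡⟨ cong (Cq *_) (ℕ→ℚ-* (j !) (j !)) ⟩
    Cq * (G * G)                                    ∎

data EvenOdd : ℕ → Set where
  even : ∀ j → EvenOdd (j ℕ.+ j)
  odd  : ∀ j → EvenOdd (suc (j ℕ.+ j))

evenOdd : ∀ n → EvenOdd n
evenOdd zero = even 0
evenOdd (suc n) with evenOdd n
... | even j = odd j
... | odd j  = subst EvenOdd (cong suc (NP.+-suc j j)) (even (suc j))

-- n = 2j: both sides equal (-1)^j C(2j,j) / 4^j.
theorem-even : ∀ j → let n = j ℕ.+ j in P n 0ℚ ≡ y6 n * sumTo n (λ k → s n k * E k)
theorem-even j = begin
  P n 0ℚ
    ≡⟨ Legendre0-even j ⟩
  binomNegHalf j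
    ≡⟨ binomNegHalf-central j ⟩
  σ * Cq * Pw
    ≡⟨ sym (QP.*-identityʳ (σ * Cq * Pw)) ⟩
  σ * Cq * Pw * (1ℚ * 1ℚ)
    ≡⟨ cong₂ (λ a b → σ * Cq * Pw * (a * b)) (sym (sgn-even j)) (sym (inv!-inverse n)) ⟩
  σ * Cq * Pw * (sgn n * (inv! n * F))
    ≡⟨ solve 6 (λ σ c p b i f → σ :* c :* p :* (b :* (i :* f)) := i :* (σ :* c) :* (f :* (b :* p)))
               refl σ Cq Pw (sgn n) (inv! n) F ⟩
  inv! n * (σ * Cq) * (F * (sgn n * Pw))
    ≡⟨ sym (cong₂ (λ a b → inv! n * a * b) alternating (stirlingEuler-sum n)) ⟩
  y6 n * sumTo n (λ k → s n k * E k) ∎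
  where
  n = j ℕ.+ j
  σ = sgn j ; F = ℕ→ℚ (n !) ; Pw = halfPow n ; Cq = ℕ→ℚ (n C j)
  alternating : sumTo n (λ k → sgn k * ℕ→ℚ ((n C k) ℕ.* (n C k))) ≡ σ * Cq
  alternating = trans (altSquareSum n) (squareDiffS-even n j)

-- n = 2j+1: both sides vanish.
theorem-odd : ∀ j → let n = suc (j ℕ.+ j) in P n 0ℚ ≡ y6 n * sumTo n (λ k → s n k * E k)
theorem-odd j = begin
  P n 0ℚ           ≡⟨ Legendre0-odd j ⟩
  0ℚ               ≡⟨ solve 2 (λ a b → con 0ℚ := a :* con 0ℚ :* b) refl (inv! n) Σ ⟩
  inv! n * 0ℚ * Σ  ≡⟨ cong (λ z → inv! n * z * Σ) (sym alternating) ⟩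
  y6 n * Σ         ∎
  where
  n = suc (j ℕ.+ j)
  Σ = sumTo n (λ k → s n k * E k)
  alternating : sumTo n (λ k → sgn k * ℕ→ℚ ((n C k) ℕ.* (n C k))) ≡ 0ℚ
  alternating = trans (altSquareSum n) (squareDiffS-odd n j)

mainTheorem4 : (n : ℕ) → P n 0ℚ ≡ y6 n * sumTo n (λ k → s n k * E k)
mainTheorem4 n with evenOdd n
... | even j = theorem-even j
... | odd  j = theorem-odd j
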